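{- Let $k$ be a positive integer and let $A_1,\dots,A_t$ be disjoint vertex sets, each of size at least $2^{10k}$, in a tournament. Suppose there is no $i\in[t-1]$ and sets $B\subseteq A_i$, $B'\subseteq A_{i+1}$ such that $B$ and $B'$ induce transitive tournaments on $k$ vertices and $B'\Rightarrow B$. Then there are sets $X_i\subseteq A_i$ ($i\in[t]$) of size $k$ such that each $X_i$ induces a transitive tournament and $X_1\Rightarrow X_2\Rightarrow\cdots\Rightarrow X_t$.
   Context: A tournament is a complete graph with every edge oriented. It is transitive if its vertices can be ordered so that every edge is oriented from the earlier to the later vertex. We write $A\Rightarrow B$ if $A$ and $B$ are disjoint and every vertex of $A$ has an edge oriented to every vertex of $B$. -}

module Defs where

open import Level using (0ℓ)
open import Data.Nat using (ℕ; suc; _<_)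
open import Data.Fin using (Fin; toℕ)
open import Data.Fin.Subset using (Subset; _∈_; _⊆_; Empty; _∩_; ∣_∣)
open import Data.Product using (Σ; _×_; ∃)
open import Data.Sum using (_⊎_)
open import Data.Empty using (⊥)
open import Relation.Nullary using (¬_)
open import Relation.Binary.PropositionalEquality using (_≡_)

record Tournament (n : ℕ) : Set₁ where
  field
    _⟶_      : Fin n → Fin n → Set
    irrefl   : ∀ u → ¬ (u ⟶ u)
    total    : ∀ u v → ¬ (u ≡ v) → (u ⟶ v) ⊎ (v ⟶ u)
    asym     : ∀ u v → u ⟶ v → ¬ (v ⟶ u)

module _ {n : ℕ} (T : Tournament n) where
  open Tournament T

  Disjoint : Subset n → Subset n → Set
  Disjoint A B = Empty (A ∩ B)

  _⇒_ : Subset n → Subset n → Set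
  A ⇒ B = Disjoint A B × (∀ u v → u ∈ A → v ∈ B → u ⟶ v)

  TransitiveOfSize : ℕ → Subset n → Set
  TransitiveOfSize k X =
    Σ (Fin k → Fin n) λ f →
      (∀ v → v ∈ X → ∃ λ i → f i ≡ v)
      × (∀ i → f i ∈ X)
      × (∀ i j → toℕ i < toℕ j → f i ⟶ f j)

-- The Xᵢ are chosen greedily from left to right.  Along the way we keep a pool
-- P ⊆ Aᵢ of 4ᵏ vertices (all of A₁ at the start).  A halving argument in the
-- style of Erdős–Moser finds inside P a transitive k-set B and, inside Aᵢ₊₁,
-- a set R of 4ᵏ vertices such that B ⇒ R or R ⇒ B.  In the second case
-- Erdős–Moser yields a transitive k-set B′ ⊆ R, so B′ ⇒ B, which is excluded.
-- Hence B ⇒ R: take Xᵢ := B and continue with the pool R.  The bound 2^{10k}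
-- is only needed in the form 4ᵏ · 4ᵏ.
module Submission where

open import Defs
open import Data.Nat using (ℕ; zero; suc; _^_; _≤_; _<_; _*_; _+_; s≤s; _≤?_)
open import Data.Nat.Properties
  using ( +-cancelˡ-≤; +-identityʳ; +-monoˡ-≤; ≰⇒>; <⇒≱; m^n>0; m^n≢0; ^-distribˡ-+-*; ^-monoʳ-≤
        ; *-monoˡ-≤; *-assoc; m≤m+n; m≤n*m; m≤n⇒m≤1+n; +-suc; +-comm; 1+n≢n; suc-injective
        ; ≤-trans; module ≤-Reasoning)
open import Data.Nat.Solver using (module +-*-Solver)
open import Data.Fin using (Fin; toℕ; zero; suc)
import Data.Fin.Properties as Fin
open import Data.Fin.Subset using (Subset; _∈_; _∉_; _⊆_; ∣_∣; ⁅_⁆; _∪_; ⊥; inside; outside)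
open import Data.Fin.Subset.Properties using (x∈⁅y⁆⇒x≡y; x∈⁅x⁆; x∈p∪q⁻; x∈p∪q⁺; ∉⊥; x∈p∩q⁻; x∈p∩q⁺)
open import Data.Vec using ([]; _∷_; here; there)
open import Data.Product using (Σ; _×_; _,_; proj₁; proj₂)
open import Data.Sum as Sum using (_⊎_; inj₁; inj₂)
open import Data.Empty using (⊥-elim)
open import Relation.Nullary using (¬_; Dec; yes; no; ¬?; contradiction)
open import Relation.Unary using (Decidable)
open import Relation.Binary.PropositionalEquality using (_≡_; _≢_; refl; sym; trans; cong; subst)
open import Function using (_∘_; flip)
open import Data.List using (List; []; _∷_; _++_; [_]; filter; length; map; lookup)
open import Data.List.Properties using (length-map; length-++)
open import Data.List.Relation.Unary.All as All using (All; []; _∷_)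
import Data.List.Relation.Unary.All.Properties as All
open import Data.List.Relation.Unary.Any using (here; there; index)
open import Data.List.Relation.Unary.Any.Properties using (lookup-index)
open import Data.List.Relation.Unary.AllPairs using (AllPairs; []; _∷_)
import Data.List.Relation.Unary.AllPairs.Properties as AllPairs
open import Data.List.Relation.Unary.Unique.Propositional using (Unique)
import Data.List.Relation.Unary.Unique.Propositional.Properties as Unique
open import Data.List.Relation.Binary.Disjoint.Propositional using () renaming (Disjoint to DisjointList)
open import Data.List.Membership.Propositional using () renaming (_∈_ to _∈ˡ_)
open import Data.List.Membership.Propositional.Properties using (∈-filter⁻; ∈-++⁻; ∈-lookup)
open import Data.List.Relation.Binary.Subset.Propositional using () renaming (_⊆_ to _⊆ˡ_)
open import Data.List.Relation.Binary.Subset.Propositional.Properties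
  using (⊆-refl; xs⊆x∷xs; ∷⁺ʳ; filter-⊆)

halves : ∀ c a b → 2 * c ≤ suc (a + b) → c ≤ a ⊎ c ≤ b
halves c a b 2c≤1+a+b with c ≤? a
... | yes c≤a = inj₁ c≤a
... | no c≰a = inj₂ (+-cancelˡ-≤ c c b (begin
  c + c       ≡⟨ cong (c +_) (sym (+-identityʳ c)) ⟩
  2 * c       ≤⟨ 2c≤1+a+b ⟩
  suc a + b   ≤⟨ +-monoˡ-≤ b (≰⇒> c≰a) ⟩
  c + b       ∎))
  where open ≤-Reasoning

2^e≰0 : ∀ e → ¬ (2 ^ e ≤ 0)
2^e≰0 e = <⇒≱ (m^n>0 2 e)

m≤2^e*m : ∀ e m → m ≤ 2 ^ e * m
m≤2^e*m e m = m≤n*m m (2 ^ e) {{m^n≢0 2 e}}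

2^4k≤2^10k : ∀ k → 2 ^ (k + k) * 2 ^ (k + k) ≤ 2 ^ (10 * k)
2^4k≤2^10k k = begin
  2 ^ (k + k) * 2 ^ (k + k)   ≡⟨ sym (^-distribˡ-+-* 2 (k + k) (k + k)) ⟩
  2 ^ ((k + k) + (k + k))     ≡⟨ cong (2 ^_) (4k≡4*k k) ⟩
  2 ^ (4 * k)                 ≤⟨ ^-monoʳ-≤ 2 (*-monoˡ-≤ k (m≤m+n 4 6)) ⟩
  2 ^ (10 * k)                ∎
  where
  open ≤-Reasoning
  open +-*-Solver
  4k≡4*k : ∀ k → (k + k) + (k + k) ≡ 4 * k
  4k≡4*k = solve 1 (λ k → (k :+ k) :+ (k :+ k) := con 4 :* k) refl

length-filter+filter-¬ : ∀ {A : Set} {P : A → Set} (P? : Decidable P) xs →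
  length (filter P? xs) + length (filter (¬? ∘ P?) xs) ≡ length xs
length-filter+filter-¬ P? [] = refl
length-filter+filter-¬ P? (x ∷ xs) with P? x
... | yes _ = cong suc (length-filter+filter-¬ P? xs)
... | no _ = trans (+-suc _ _) (cong suc (length-filter+filter-¬ P? xs))

filter-halves : ∀ {A : Set} {P : A → Set} (P? : Decidable P) xs {c} → 2 * c ≤ suc (length xs) →
  c ≤ length (filter P? xs) ⊎ c ≤ length (filter (¬? ∘ P?) xs)
filter-halves P? xs {c} 2c≤1+xs =
  halves c _ _ (subst (λ l → 2 * c ≤ suc l) (sym (length-filter+filter-¬ P? xs)) 2c≤1+xs)

AllPairs-lookup : ∀ {A : Set} {R : A → A → Set} {xs : List A} → AllPairs R xs →
  ∀ i j → toℕ i < toℕ j → R (lookup xs i) (lookup xs j)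
AllPairs-lookup (Rx ∷ _) zero (suc j) _ = All.lookup Rx (∈-lookup j)
AllPairs-lookup (_ ∷ R) (suc i) (suc j) (s≤s i<j) = AllPairs-lookup R i j i<j

Consecutive : ∀ {A : Set} {t} → (A → A → Set) → (Fin t → A) → Set
Consecutive R X = ∀ i j → toℕ j ≡ suc (toℕ i) → R (X i) (X j)

Consecutive-tail : ∀ {A : Set} {t} {R : A → A → Set} {X : Fin (suc t) → A} →
  Consecutive R X → Consecutive R (X ∘ suc)
Consecutive-tail R-X i j j≡1+i = R-X (suc i) (suc j) (cong suc j≡1+i)

Consecutive-cons : ∀ {A : Set} {t} {R : A → A → Set} (X : Fin (suc (suc t)) → A) →
  R (X zero) (X (suc zero)) → Consecutive R (X ∘ suc) → Consecutive R X
Consecutive-cons X R₀₁ R-tail zero (suc zero) refl = R₀₁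
Consecutive-cons X R₀₁ R-tail (suc i) (suc j) j≡1+i = R-tail i j (suc-injective j≡1+i)
Consecutive-cons X R₀₁ R-tail zero zero ()
Consecutive-cons X R₀₁ R-tail zero (suc (suc j)) ()
Consecutive-cons X R₀₁ R-tail (suc i) zero ()

consecutive⇒≢ : ∀ {t} {i j : Fin t} → toℕ j ≡ suc (toℕ i) → i ≢ j
consecutive⇒≢ j≡1+i refl = 1+n≢n (sym j≡1+i)

elements : ∀ {n} → Subset n → List (Fin n)
elements [] = []
elements (inside ∷ p) = zero ∷ map suc (elements p)
elements (outside ∷ p) = map suc (elements p)

length-elements : ∀ {n} (p : Subset n) → length (elements p) ≡ ∣ p ∣
length-elements [] = refl
length-elements (inside ∷ p) = cong suc (trans (length-map suc (elements p)) (length-elements p))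
length-elements (outside ∷ p) = trans (length-map suc (elements p)) (length-elements p)

elements-∈ : ∀ {n} (p : Subset n) → All (_∈ p) (elements p)
elements-∈ [] = []
elements-∈ (inside ∷ p) = here ∷ All.map⁺ (All.map there (elements-∈ p))
elements-∈ (outside ∷ p) = All.map⁺ (All.map there (elements-∈ p))

elements-unique : ∀ {n} (p : Subset n) → Unique (elements p)
elements-unique [] = []
elements-unique (inside ∷ p) =
  All.map⁺ (All.universal (λ _ ()) (elements p)) ∷ Unique.map⁺ Fin.suc-injective (elements-unique p)
elements-unique (outside ∷ p) = Unique.map⁺ Fin.suc-injective (elements-unique p)

toSubset : ∀ {n} → List (Fin n) → Subset n
toSubset [] = ⊥
toSubset (x ∷ xs) = ⁅ x ⁆ ∪ toSubset xs

∈-toSubset⁻ : ∀ {n} {xs : List (Fin n)} {v} → v ∈ toSubset xs → v ∈ˡ xs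
∈-toSubset⁻ {xs = []} v∈ = ⊥-elim (∉⊥ v∈)
∈-toSubset⁻ {xs = x ∷ xs} v∈ with x∈p∪q⁻ ⁅ x ⁆ (toSubset xs) v∈
... | inj₁ v∈⁅x⁆ = here (x∈⁅y⁆⇒x≡y x v∈⁅x⁆)
... | inj₂ v∈xs = there (∈-toSubset⁻ v∈xs)

∈-toSubset⁺ : ∀ {n} {xs : List (Fin n)} {v} → v ∈ˡ xs → v ∈ toSubset xs
∈-toSubset⁺ (here refl) = x∈p∪q⁺ (inj₁ (x∈⁅x⁆ _))
∈-toSubset⁺ (there v∈) = x∈p∪q⁺ (inj₂ (∈-toSubset⁺ v∈))

module _ {n : ℕ} (T : Tournament n) where
  open Tournament T

  V : Set
  V = Fin n

  Disjoint⁺ : ∀ {X Y} → (∀ {v} → v ∈ X → v ∉ Y) → Disjoint T X Y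
  Disjoint⁺ {X} {Y} X#Y (v , v∈X∩Y) = let v∈X , v∈Y = x∈p∩q⁻ X Y v∈X∩Y in X#Y v∈X v∈Y

  Disjoint⁻ : ∀ {X Y v} → Disjoint T X Y → v ∈ X → v ∉ Y
  Disjoint⁻ X#Y v∈X v∈Y = X#Y (_ , x∈p∩q⁺ (v∈X , v∈Y))

  Disjoint⇒DisjointList : ∀ {A A′ P R} → All (_∈ A) P → All (_∈ A′) R →
    Disjoint T A A′ → DisjointList P R
  Disjoint⇒DisjointList P⊆A R⊆A′ A#A′ (v∈P , v∈R) =
    Disjoint⁻ A#A′ (All.lookup P⊆A v∈P) (All.lookup R⊆A′ v∈R)

  DisjointList-mono : ∀ {P P′ R R′ : List V} → P′ ⊆ˡ P → R′ ⊆ˡ R →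
    DisjointList P R → DisjointList P′ R′
  DisjointList-mono P′⊆P R′⊆R P#R (v∈P′ , v∈R′) = P#R (P′⊆P v∈P′ , R′⊆R v∈R′)

  NoBackwardPair : ℕ → Subset n → Subset n → Set
  NoBackwardPair k A A′ = ∀ (B B′ : Subset n) → B ⊆ A → B′ ⊆ A′
    → TransitiveOfSize T k B → TransitiveOfSize T k B′ → ¬ (_⇒_ T B′ B)

  _⟵_ : V → V → Set
  _⟵_ = flip _⟶_

  _⟶?_ : ∀ u v → Dec (u ⟶ v)
  u ⟶? v with u Fin.≟ v
  ... | yes refl = no (irrefl u)
  ... | no u≢v with total u v u≢v
  ...   | inj₁ u⟶v = yes u⟶v
  ...   | inj₂ v⟶u = no (asym v u v⟶u)

  ¬⟶⇒⟵ : ∀ {u v} → u ≢ v → ¬ (u ⟶ v) → v ⟶ u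
  ¬⟶⇒⟵ {u} {v} u≢v u↛v with total u v u≢v
  ... | inj₁ u⟶v = contradiction u⟶v u↛v
  ... | inj₂ v⟶u = v⟶u

  successors nonSuccessors : V → List V → List V
  successors x = filter (x ⟶?_)
  nonSuccessors x = filter (¬? ∘ (x ⟶?_))

  successors⊆ : ∀ x xs → successors x xs ⊆ˡ xs
  successors⊆ x = filter-⊆ (x ⟶?_)

  nonSuccessors⊆ : ∀ x xs → nonSuccessors x xs ⊆ˡ xs
  nonSuccessors⊆ x = filter-⊆ (¬? ∘ (x ⟶?_))

  successors-unique : ∀ x {xs} → Unique xs → Unique (successors x xs)
  successors-unique x = Unique.filter⁺ (x ⟶?_)

  nonSuccessors-unique : ∀ x {xs} → Unique xs → Unique (nonSuccessors x xs)
  nonSuccessors-unique x = Unique.filter⁺ (¬? ∘ (x ⟶?_))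

  ∈-successors⁻ : ∀ x xs {y} → y ∈ˡ successors x xs → x ⟶ y
  ∈-successors⁻ x xs = proj₂ ∘ ∈-filter⁻ (x ⟶?_) {xs = xs}

  ∈-nonSuccessors⁻ : ∀ x xs {y} → y ∈ˡ nonSuccessors x xs → y ∈ˡ xs × ¬ (x ⟶ y)
  ∈-nonSuccessors⁻ x xs = ∈-filter⁻ (¬? ∘ (x ⟶?_)) {xs = xs}

  Chain : List V → Set
  Chain = AllPairs _⟶_

  record ChainIn (m : ℕ) (S : List V) : Set where
    constructor chainIn
    field
      vertices : List V
      length≡ : length vertices ≡ m
      chain : Chain vertices
      vertices⊆S : vertices ⊆ˡ S

  open ChainIn

  ChainIn-mono : ∀ {m S S′} → S ⊆ˡ S′ → ChainIn m S → ChainIn m S′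
  ChainIn-mono S⊆S′ (chainIn C len ch C⊆S) = chainIn C len ch (S⊆S′ ∘ C⊆S)

  ⟦_⟧ : ∀ {m S} → ChainIn m S → Subset n
  ⟦ C ⟧ = toSubset (vertices C)

  ⟦⟧-⊆ : ∀ {m S A} (C : ChainIn m S) → All (_∈ A) S → ⟦ C ⟧ ⊆ A
  ⟦⟧-⊆ C S⊆A = All.lookup (All.anti-mono (vertices⊆S C) S⊆A) ∘ ∈-toSubset⁻

  ⟦⟧-transitive : ∀ {m S} (C : ChainIn m S) → TransitiveOfSize T m ⟦ C ⟧
  ⟦⟧-transitive (chainIn C refl ch _) =
      lookup C
    , (λ v v∈ → let v∈C = ∈-toSubset⁻ {xs = C} v∈ in index v∈C , sym (lookup-index v∈C))
    , (λ i → ∈-toSubset⁺ (∈-lookup {xs = C} i))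
    , AllPairs-lookup ch

  ExtendsChainsIn : V → List V → Set
  ExtendsChainsIn x S =
    ∀ {m} (C : ChainIn m S) → Σ (ChainIn (suc m) (x ∷ S)) λ C′ → vertices C′ ⊆ˡ x ∷ vertices C

  extensionOf : ∀ {x m S} (C : ChainIn m S) {C′} → length C′ ≡ suc m → Chain C′ →
    C′ ⊆ˡ x ∷ vertices C → Σ (ChainIn (suc m) (x ∷ S)) λ D → vertices D ⊆ˡ x ∷ vertices C
  extensionOf {x} C len ch C′⊆ = chainIn _ len ch (∷⁺ʳ x (vertices⊆S C) ∘ C′⊆) , C′⊆

  successors-extend : ∀ x xs → ExtendsChainsIn x (successors x xs)
  successors-extend x xs C@(chainIn vs len ch vs⊆S) =
    extensionOf C (cong suc len) (All.tabulate (∈-successors⁻ x xs ∘ vs⊆S) ∷ ch) ⊆-refl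

  nonSuccessors-extend : ∀ x xs → All (x ≢_) xs → ExtendsChainsIn x (nonSuccessors x xs)
  nonSuccessors-extend x xs x∉xs C@(chainIn vs len ch vs⊆S) =
    extensionOf C len′ (AllPairs.++⁺ ch ([] ∷ []) (All.tabulate (λ y∈ → ⟶x y∈ ∷ []))) vs′⊆
    where
    len′ : length (vs ++ [ x ]) ≡ suc _
    len′ = trans (length-++ vs) (trans (+-comm (length vs) 1) (cong suc len))
    ⟶x : ∀ {y} → y ∈ˡ vs → y ⟶ x
    ⟶x y∈ with ∈-nonSuccessors⁻ x xs (vs⊆S y∈)
    ... | y∈xs , x↛y = ¬⟶⇒⟵ (All.lookup x∉xs y∈xs) x↛y
    vs′⊆ : vs ++ [ x ] ⊆ˡ x ∷ vs
    vs′⊆ y∈ with ∈-++⁻ vs y∈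
    ... | inj₁ y∈vs = there y∈vs
    ... | inj₂ (here y≡x) = here y≡x

  record LargePart (x : V) (xs : List V) (m : ℕ) : Set where
    field
      part : List V
      part⊆ : part ⊆ˡ xs
      part-unique : Unique part
      part-large : 2 ^ m ≤ length part
      part-extends : ExtendsChainsIn x part

    part⊆x∷xs : part ⊆ˡ x ∷ xs
    part⊆x∷xs = xs⊆x∷xs xs x ∘ part⊆

    extend : ∀ {a} → ChainIn a part → ChainIn (suc a) (x ∷ xs)
    extend = ChainIn-mono (∷⁺ʳ x part⊆) ∘ proj₁ ∘ part-extends

  largePart : ∀ m x xs → Unique (x ∷ xs) → 2 ^ suc m ≤ length (x ∷ xs) → LargePart x xs m
  largePart m x xs (x∉xs ∷ uxs) h
    with filter-halves (x ⟶?_) xs h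
  ... | inj₁ large = record
    { part = successors x xs ; part⊆ = successors⊆ x xs ; part-unique = successors-unique x uxs
    ; part-large = large ; part-extends = successors-extend x xs }
  ... | inj₂ large = record
    { part = nonSuccessors x xs ; part⊆ = nonSuccessors⊆ x xs ; part-unique = nonSuccessors-unique x uxs
    ; part-large = large ; part-extends = nonSuccessors-extend x xs x∉xs }

  erdősMoser : ∀ m {S} → Unique S → 2 ^ m ≤ length S → ChainIn m S
  erdősMoser zero _ _ = chainIn [] refl [] (λ ())
  erdősMoser (suc m) {[]} _ h = contradiction h (2^e≰0 (suc m))
  erdősMoser (suc m) {x ∷ xs} u h =
    extend (erdősMoser m part-unique part-large)
    where open LargePart (largePart m x xs u h)

  record Fan (_↝_ : V → V → Set) (a M : ℕ) (P R : List V) : Set where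
    field
      source : ChainIn a P
      targets : List V
      targets⊆R : targets ⊆ˡ R
      targets-unique : Unique targets
      targets-many : M ≤ length targets
      fans : ∀ {x r} → x ∈ˡ vertices source → r ∈ˡ targets → x ↝ r

  emptyFan : ∀ {_↝_ M P R} → Unique R → M ≤ length R → Fan _↝_ 0 M P R
  emptyFan {R = R} uR M≤ = record
    { source = chainIn [] refl [] (λ ()) ; targets = R ; targets⊆R = ⊆-refl
    ; targets-unique = uR ; targets-many = M≤ ; fans = λ () }

  Fan-mono : ∀ {_↝_ a M P P′ R R′} → P ⊆ˡ P′ → R ⊆ˡ R′ → Fan _↝_ a M P R → Fan _↝_ a M P′ R′
  Fan-mono P⊆P′ R⊆R′ F = record
    { source = ChainIn-mono P⊆P′ source ; targets = targets ; targets⊆R = R⊆R′ ∘ targets⊆R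
    ; targets-unique = targets-unique ; targets-many = targets-many ; fans = fans }
    where open Fan F

  Fan-extend : ∀ {_↝_ a M x xs m R} (p : LargePart x xs m) → (∀ {r} → r ∈ˡ R → x ↝ r) →
    Fan _↝_ a M (LargePart.part p) R → Fan _↝_ (suc a) M (x ∷ xs) R
  Fan-extend {_↝_} {x = x} {R = R} p x↝R F = record
    { source = LargePart.extend p source ; targets = targets ; targets⊆R = targets⊆R
    ; targets-unique = targets-unique ; targets-many = targets-many ; fans = fans′ }
    where
    open Fan F
    fans′ : ∀ {y r} → y ∈ˡ vertices (LargePart.extend p source) → r ∈ˡ targets → y ↝ r
    fans′ y∈ r∈ with proj₂ (LargePart.part-extends p source) y∈
    ... | here refl = x↝R (targets⊆R r∈)
    ... | there y∈C = fans y∈C r∈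

  -- Pick x ∈ P.  By largePart, x extends every chain in a set of half the
  -- remaining size of P; and x is a common source (resp. target) for its
  -- successors (resp. non-successors) in R, one of which is half of R.
  -- Recurse with a (resp. b) lowered by one.
  fanDichotomy : ∀ M a b {P R} → Unique P → Unique R → DisjointList P R
    → 2 ^ (a + b) ≤ length P → 2 ^ (a + b) * M ≤ length R
    → Fan _⟶_ a M P R ⊎ Fan _⟵_ b M P R
  fanDichotomy M zero b _ uR _ _ hR = inj₁ (emptyFan uR (≤-trans (m≤2^e*m b M) hR))
  fanDichotomy M (suc a) zero _ uR _ _ hR =
    inj₂ (emptyFan uR (≤-trans (m≤2^e*m (suc a + 0) M) hR))
  fanDichotomy M (suc a) (suc b) {[]} _ _ _ hP _ = contradiction hP (2^e≰0 (suc a + suc b))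
  fanDichotomy M (suc a) (suc b) {x ∷ xs} {R} uP uR P#R hP hR
    with largePart (a + suc b) x xs uP hP
       | filter-halves (x ⟶?_) R (m≤n⇒m≤1+n (subst (_≤ length R) (*-assoc 2 (2 ^ (a + suc b)) M) hR))
  ... | p | inj₁ many =
    Sum.map (Fan-mono ⊆-refl (successors⊆ x R) ∘ Fan-extend p (∈-successors⁻ x R))
            (Fan-mono part⊆x∷xs (successors⊆ x R))
            (fanDichotomy M a (suc b) part-unique (successors-unique x uR)
               (DisjointList-mono part⊆x∷xs (successors⊆ x R) P#R) part-large many)
    where open LargePart p
  ... | p | inj₂ many =
    Sum.map (Fan-mono part⊆x∷xs (nonSuccessors⊆ x R))
            (Fan-mono ⊆-refl (nonSuccessors⊆ x R) ∘ Fan-extend p x⟵)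
            (fanDichotomy M (suc a) b part-unique (nonSuccessors-unique x uR)
               (DisjointList-mono part⊆x∷xs (nonSuccessors⊆ x R) P#R)
               (subst (λ e → 2 ^ e ≤ length part) (+-suc a b) part-large)
               (subst (λ e → 2 ^ e * M ≤ length (nonSuccessors x R)) (+-suc a b) many))
    where
    open LargePart p
    x⟵ : ∀ {r} → r ∈ˡ nonSuccessors x R → x ⟵ r
    x⟵ r∈ with ∈-nonSuccessors⁻ x R r∈
    ... | r∈R , x↛r = ¬⟶⇒⟵ (λ { refl → P#R (here refl , r∈R) }) x↛r

  forwardFan : ∀ {k M A A′ P R} → 2 ^ k ≤ M → Disjoint T A A′ → NoBackwardPair k A A′
    → Unique P → Unique R → All (_∈ A) P → All (_∈ A′) R
    → 2 ^ (k + k) ≤ length P → 2 ^ (k + k) * M ≤ length R → Fan _⟶_ k M P R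
  forwardFan {k} {M} {A} {A′} 2^k≤M A#A′ noBackward uP uR P⊆A R⊆A′ hP hR
    with fanDichotomy M k k uP uR (Disjoint⇒DisjointList P⊆A R⊆A′ A#A′) hP hR
  ... | inj₁ forward = forward
  ... | inj₂ backward =
    ⊥-elim (noBackward ⟦ source ⟧ ⟦ C ⟧ B⊆A C⊆A′ (⟦⟧-transitive source) (⟦⟧-transitive C) C⇒B)
    where
    open Fan backward
    C : ChainIn k targets
    C = erdősMoser k targets-unique (≤-trans 2^k≤M targets-many)
    B⊆A : ⟦ source ⟧ ⊆ A
    B⊆A = ⟦⟧-⊆ source P⊆A
    C⊆A′ : ⟦ C ⟧ ⊆ A′
    C⊆A′ = ⟦⟧-⊆ C (All.anti-mono targets⊆R R⊆A′)
    C⇒B : _⇒_ T ⟦ C ⟧ ⟦ source ⟧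
    C⇒B = Disjoint⁺ (λ v∈C v∈B → Disjoint⁻ A#A′ (B⊆A v∈B) (C⊆A′ v∈C))
        , λ u v u∈C v∈B → fans (∈-toSubset⁻ v∈B) (vertices⊆S C (∈-toSubset⁻ u∈C))

  TransitiveSequence : ∀ {t} → ℕ → (Fin t → Subset n) → Set
  TransitiveSequence {t} k A = Σ (Fin t → Subset n) λ X →
    (∀ i → X i ⊆ A i) × (∀ i → TransitiveOfSize T k (X i)) × Consecutive (_⇒_ T) X

  transitiveSequence : ∀ k t (A : Fin (suc t) → Subset n)
    → Consecutive (Disjoint T) A → Consecutive (NoBackwardPair k) A
    → (∀ i → 2 ^ (k + k) * 2 ^ (k + k) ≤ ∣ A (suc i) ∣)
    → ∀ {P} → Unique P → All (_∈ A zero) P → 2 ^ (k + k) ≤ length P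
    → Σ (TransitiveSequence k A) λ X → ∀ {v} → v ∈ proj₁ X zero → v ∈ˡ P
  transitiveSequence k zero A _ _ _ uP P⊆A hP =
      ((λ _ → ⟦ C ⟧) , (λ { zero → ⟦⟧-⊆ C P⊆A }) , (λ _ → ⟦⟧-transitive C) , λ { zero zero () })
    , vertices⊆S C ∘ ∈-toSubset⁻
    where
    C = erdősMoser k uP (≤-trans (^-monoʳ-≤ 2 (m≤m+n k k)) hP)
  transitiveSequence k (suc t) A disjoint noBackward large {P} uP P⊆A hP
    with forwardFan (^-monoʳ-≤ 2 (m≤m+n k k)) (disjoint zero (suc zero) refl)
           (noBackward zero (suc zero) refl) uP (elements-unique (A (suc zero))) P⊆A
           (elements-∈ (A (suc zero)))
           hP (subst (_ ≤_) (sym (length-elements (A (suc zero)))) (large zero))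
  ... | fan with transitiveSequence k t (A ∘ suc) (Consecutive-tail {R = Disjoint T} disjoint)
                   (Consecutive-tail {R = NoBackwardPair k} noBackward) (large ∘ suc) (Fan.targets-unique fan)
                   (All.anti-mono (Fan.targets⊆R fan) (elements-∈ (A (suc zero)))) (Fan.targets-many fan)
  ...   | (X′ , X′⊆A , X′-transitive , X′-consecutive) , X′₀⊆targets =
      (X , X⊆A , X-transitive , Consecutive-cons {R = _⇒_ T} X X₀⇒X₁ X′-consecutive)
    , vertices⊆S source ∘ ∈-toSubset⁻
    where
    open Fan fan
    X : Fin (suc (suc t)) → Subset n
    X zero = ⟦ source ⟧
    X (suc i) = X′ i
    X⊆A : ∀ i → X i ⊆ A i
    X⊆A zero = ⟦⟧-⊆ source P⊆A
    X⊆A (suc i) = X′⊆A i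
    X-transitive : ∀ i → TransitiveOfSize T k (X i)
    X-transitive zero = ⟦⟧-transitive source
    X-transitive (suc i) = X′-transitive i
    X₀⇒X₁ : _⇒_ T (X zero) (X (suc zero))
    X₀⇒X₁ = Disjoint⁺ (λ v∈X₀ v∈X₁ → Disjoint⁻ (disjoint zero (suc zero) refl) (X⊆A zero v∈X₀) (X′⊆A zero v∈X₁))
          , λ u v u∈X₀ v∈X₁ → fans (∈-toSubset⁻ u∈X₀) (X′₀⊆targets v∈X₁)

lemma2p6 : ∀ {n} (T : Tournament n) (k t : ℕ) (A : Fin t → Subset n)
    → 1 ≤ k
    → (∀ i j → ¬ (i ≡ j) → Disjoint T (A i) (A j))
    → (∀ i → 2 ^ (10 * k) ≤ ∣ A i ∣)
    → (∀ (i j : Fin t) → toℕ j ≡ suc (toℕ i) → ∀ (B B′ : Subset n)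
    → B ⊆ A i → B′ ⊆ A j
    → TransitiveOfSize T k B → TransitiveOfSize T k B′
    → ¬ (_⇒_ T B′ B))
    → Σ (Fin t → Subset n) λ X →
    (∀ i → X i ⊆ A i)
    × (∀ i → TransitiveOfSize T k (X i))
    × (∀ (i j : Fin t) → toℕ j ≡ suc (toℕ i) → _⇒_ T (X i) (X j))
lemma2p6 T k zero A _ _ _ _ = (λ ()) , (λ ()) , (λ ()) , (λ ())
lemma2p6 T k (suc t) A _ disjoint large noBackward =
  proj₁ (transitiveSequence T k t A
           (λ i j j≡1+i → disjoint i j (consecutive⇒≢ j≡1+i)) noBackward
           (λ i → ≤-trans (2^4k≤2^10k k) (large (suc i)))
           (elements-unique (A zero)) (elements-∈ (A zero)) pool-large)
  where
  pool-large : 2 ^ (k + k) ≤ length (elements (A zero))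
  pool-large = subst (2 ^ (k + k) ≤_) (sym (length-elements (A zero)))
                 (≤-trans (m≤2^e*m (k + k) (2 ^ (k + k))) (≤-trans (2^4k≤2^10k k) (large zero)))
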